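{- Let $G$ be a bipartite graph, and let $S$ be a stable set of $G$ that meets at least one edge of $G$ but is not a vertex cover of $G$. Then the colouring of $E(G)$ in which an edge is red if it has an endpoint in $S$ and blue otherwise is a NAC-colouring of $G$; in particular it is a stable NAC-colouring.
   Context: A NAC-colouring of a graph $G$ is a surjective map $E(G)\to\{\text{red},\text{blue}\}$ such that no cycle of $G$ contains exactly one red edge or exactly one blue edge. A NAC-colouring is stable if there is a stable set $S_c$ of vertices such that all edges meeting $S_c$ have one colour and all edges not meeting $S_c$ have the other colour. -}

module Defs where

open import Data.Nat using (ℕ; _≤_)
open import Data.Fin using (Fin)
open import Data.Bool using (Bool; true; false; _∨_; if_then_else_)
open import Data.List using (List; []; _∷_; length; zip; _++_; [_]; filter)
open import Data.List.Relation.Unary.All using (All)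
open import Data.List.Relation.Unary.Unique.Propositional using (Unique)
open import Data.Product using (Σ; _×_; _,_; ∃; ∃-syntax)
open import Relation.Binary.PropositionalEquality using (_≡_; _≢_)
open import Relation.Nullary using (¬_; Dec; yes; no)

record Graph : Set where
  field
    n      : ℕ
    adj    : Fin n → Fin n → Bool
    sym    : ∀ u v → adj u v ≡ adj v u
    irrefl : ∀ v → adj v v ≡ false
open Graph public

Edge : (G : Graph) → Fin (n G) → Fin (n G) → Set
Edge G u v = adj G u v ≡ true

data Colour : Set where
  red blue : Colour

_≟c_ : (a b : Colour) → Dec (a ≡ b)
red  ≟c red  = yes _≡_.refl
red  ≟c blue = no λ ()
blue ≟c red  = no λ ()
blue ≟c blue = yes _≡_.refl

-- A colouring of the edges: a colour for every ordered pair, required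
-- (in IsNAC) to be symmetric on edges, so it is a map E(G) → Colour.
Colouring : Graph → Set
Colouring G = Fin (n G) → Fin (n G) → Colour

VSet : Graph → Set
VSet G = Fin (n G) → Bool

Bipartite : Graph → Set
Bipartite G = Σ (Fin (n G) → Bool) λ f → ∀ u v → Edge G u v → ¬ (f u ≡ f v)

StableSet : (G : Graph) → VSet G → Set
StableSet G S = ∀ u v → Edge G u v → ¬ (S u ≡ true × S v ≡ true)

MeetsSomeEdge : (G : Graph) → VSet G → Set
MeetsSomeEdge G S = ∃[ u ] ∃[ v ] (Edge G u v × S u ≡ true)

VertexCover : (G : Graph) → VSet G → Set
VertexCover G S = ∀ u v → Edge G u v → (S u ∨ S v) ≡ true

-- Cycles: a list of pairwise distinct vertices v0 … v(k-1), k ≥ 3,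
-- with v_i v_{i+1} and v_{k-1} v_0 edges.
cycleEdges : {A : Set} → List A → List (Σ A λ _ → A)
cycleEdges []       = []
cycleEdges (x ∷ xs) = zip (x ∷ xs) (xs ++ [ x ])

record Cycle (G : Graph) : Set where
  field
    verts    : List (Fin (n G))
    long     : 3 ≤ length verts
    distinct : Unique verts
    edges    : All (λ e → Edge G (Σ.proj₁ e) (Σ.proj₂ e)) (cycleEdges verts)
open Cycle public

countColour : (G : Graph) → Colouring G → Cycle G → Colour → ℕ
countColour G c C a =
  length (filter (λ e → c (Σ.proj₁ e) (Σ.proj₂ e) ≟c a) (cycleEdges (verts C)))

IsNAC : (G : Graph) → Colouring G → Set
IsNAC G c =
  (∀ u v → Edge G u v → c u v ≡ c v u)
  × (∃[ u ] ∃[ v ] (Edge G u v × c u v ≡ red))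
  × (∃[ u ] ∃[ v ] (Edge G u v × c u v ≡ blue))
  × (∀ (C : Cycle G) → countColour G c C red  ≢ 1
                     × countColour G c C blue ≢ 1)

IsStableNAC : (G : Graph) → Colouring G → Set
IsStableNAC G c =
  IsNAC G c ×
  (∃[ Sc ] (StableSet G Sc × ∃[ a ] ∃[ b ] (¬ (a ≡ b) ×
     ( ∀ u v → Edge G u v →
         ((Sc u ∨ Sc v) ≡ true  → c u v ≡ a)
       × ((Sc u ∨ Sc v) ≡ false → c u v ≡ b)))))

colourBy : (G : Graph) → VSet G → Colouring G
colourBy G S u v = if S u ∨ S v then red else blue

{-# OPTIONS --safe #-}
-- Both colour classes of the colouring are edge cuts.  Since S is stable,
-- an edge is red exactly when it has one end in S, so the red class is the
-- cut of S.  If A is one side of a bipartition, every edge has exactly one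
-- end in A, so an edge is blue exactly when it crosses the cut of the
-- symmetric difference A △ S.  A cycle crosses every cut an even number of
-- times, hence it never contains exactly one edge of either colour.
-- Both colours occur because S meets an edge but does not cover all of them.
module Submission where

open import Defs hiding (sym)
open import Algebra.Bundles using (CommutativeRing)
open import Algebra.Properties.CommutativeSemigroup using (interchange)
open import Data.Bool using (Bool; true; false; not; _∨_; _xor_; if_then_else_)
open import Data.Bool.Properties
  using (∨-comm; xor-assoc; xor-same; xor-identityʳ; true-xor; xor-∧-commutativeRing)
  renaming (_≟_ to _≟ᵇ_)
open import Data.Fin using (Fin)
open import Data.Fin.Properties using (any?)
open import Data.List using (List; []; _∷_; _++_; [_]; length; filter; foldr; map; zip)
open import Data.List.Properties using (map-cong-local)
import Data.List.Relation.Unary.All as All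
open import Data.Nat using (ℕ; zero; suc)
open import Data.Product using (_×_; _,_; ∃-syntax)
open import Function using (_∘_; case_of_)
open import Relation.Nullary using (¬_; does; yes; no)
open import Relation.Nullary.Decidable using (_×-dec_)
open import Relation.Unary using (Pred; Decidable)
open import Relation.Binary.PropositionalEquality
  using (_≡_; _≢_; refl; sym; trans; cong; module ≡-Reasoning)
open ≡-Reasoning

odd : ℕ → Bool
odd zero    = false
odd (suc k) = not (odd k)

xorSum : List Bool → Bool
xorSum = foldr _xor_ false

odd-length-filter : ∀ {a p} {A : Set a} {P : Pred A p} (P? : Decidable P) (xs : List A) →
                    odd (length (filter P? xs)) ≡ xorSum (map (does ∘ P?) xs)
odd-length-filter P? []       = refl
odd-length-filter P? (x ∷ xs) with does (P? x)
... | true  = cong not (odd-length-filter P? xs)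
... | false = odd-length-filter P? xs

xor-telescope : ∀ x y z → (x xor y) xor (y xor z) ≡ x xor z
xor-telescope x y z = begin
  (x xor y) xor (y xor z) ≡⟨ xor-assoc x y (y xor z) ⟩
  x xor (y xor (y xor z)) ≡⟨ cong (x xor_) (sym (xor-assoc y y z)) ⟩
  x xor ((y xor y) xor z) ≡⟨ cong (λ w → x xor (w xor z)) (xor-same y) ⟩
  x xor z                 ∎

xor-interchange : ∀ w x y z → (w xor x) xor (y xor z) ≡ (w xor y) xor (x xor z)
xor-interchange = interchange +-commutativeSemigroup
  where open CommutativeRing xor-∧-commutativeRing using (+-commutativeSemigroup)

∨≡xor : ∀ {x y} → ¬ (x ≡ true × y ≡ true) → x ∨ y ≡ x xor y
∨≡xor {true}  {true}  ¬both = case ¬both (refl , refl) of λ ()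
∨≡xor {true}  {false} _     = refl
∨≡xor {false} {_}     _     = refl

xor≡true : ∀ {x y} → x ≢ y → x xor y ≡ true
xor≡true {true}  {true}  x≢y = case x≢y refl of λ ()
xor≡true {true}  {false} _   = refl
xor≡true {false} {true}  _   = refl
xor≡true {false} {false} x≢y = case x≢y refl of λ ()

module _ {A : Set} (h : A → Bool) where

  crosses : A × A → Bool
  crosses (u , v) = h u xor h v

  xorSum-crosses-path : ∀ a b ys → xorSum (map crosses (zip (a ∷ ys) (ys ++ [ b ]))) ≡ h a xor h b
  xorSum-crosses-path a b []       = xor-identityʳ (h a xor h b)
  xorSum-crosses-path a b (y ∷ ys) = begin
    (h a xor h y) xor xorSum (map crosses (zip (y ∷ ys) (ys ++ [ b ])))
      ≡⟨ cong ((h a xor h y) xor_) (xorSum-crosses-path y b ys) ⟩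
    (h a xor h y) xor (h y xor h b)
      ≡⟨ xor-telescope (h a) (h y) (h b) ⟩
    h a xor h b ∎

  xorSum-crosses-cycle : ∀ xs → xorSum (map crosses (cycleEdges xs)) ≡ false
  xorSum-crosses-cycle []       = refl
  xorSum-crosses-cycle (x ∷ xs) = trans (xorSum-crosses-path x x xs) (xor-same (h x))

module _ (G : Graph) (c : Colouring G) where

  ColourClassIsCut : Colour → (Fin (n G) → Bool) → Set
  ColourClassIsCut a h = ∀ u v → Edge G u v → does (c u v ≟c a) ≡ crosses h (u , v)

  countColour-even : ∀ {a} h → ColourClassIsCut a h → (C : Cycle G) →
                     odd (countColour G c C a) ≡ false
  countColour-even {a} h cut C = begin
    odd (countColour G c C a)
      ≡⟨ odd-length-filter _ (cycleEdges (verts C)) ⟩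
    xorSum (map (λ (u , v) → does (c u v ≟c a)) (cycleEdges (verts C)))
      ≡⟨ cong xorSum (map-cong-local (All.map (λ {(u , v)} → cut u v) (edges C))) ⟩
    xorSum (map (crosses h) (cycleEdges (verts C)))
      ≡⟨ xorSum-crosses-cycle h (verts C) ⟩
    false ∎

  countColour≢1 : ∀ {a} h → ColourClassIsCut a h → (C : Cycle G) → countColour G c C a ≢ 1
  countColour≢1 h cut C count≡1 =
    case trans (cong odd (sym count≡1)) (countColour-even h cut C) of λ ()

module _ (G : Graph) (S : VSet G) where

  colourBy-true : ∀ {u v} → (S u ∨ S v) ≡ true → colourBy G S u v ≡ red
  colourBy-true = cong (if_then red else blue)

  colourBy-false : ∀ {u v} → (S u ∨ S v) ≡ false → colourBy G S u v ≡ blue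
  colourBy-false = cong (if_then red else blue)

  colourBy-sym : ∀ u v → colourBy G S u v ≡ colourBy G S v u
  colourBy-sym u v = cong (if_then red else blue) (∨-comm (S u) (S v))

  red-indicator : ∀ u v → does (colourBy G S u v ≟c red) ≡ S u ∨ S v
  red-indicator u v with S u ∨ S v
  ... | true  = refl
  ... | false = refl

  blue-indicator : ∀ u v → does (colourBy G S u v ≟c blue) ≡ not (S u ∨ S v)
  blue-indicator u v with S u ∨ S v
  ... | true  = refl
  ... | false = refl

  red-class-isCut : StableSet G S → ColourClassIsCut G (colourBy G S) red S
  red-class-isCut stable u v uv = trans (red-indicator u v) (∨≡xor (stable u v uv))

  blue-class-isCut : (A : VSet G) → (∀ u v → Edge G u v → A u ≢ A v) → StableSet G S →
                     ColourClassIsCut G (colourBy G S) blue (λ w → A w xor S w)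
  blue-class-isCut A bipartition stable u v uv = begin
    does (colourBy G S u v ≟c blue)    ≡⟨ blue-indicator u v ⟩
    not (S u ∨ S v)                    ≡⟨ cong not (∨≡xor (stable u v uv)) ⟩
    not (S u xor S v)                  ≡⟨ sym (true-xor (S u xor S v)) ⟩
    true xor (S u xor S v)             ≡⟨ cong (_xor (S u xor S v)) (sym (xor≡true (bipartition u v uv))) ⟩
    (A u xor A v) xor (S u xor S v)    ≡⟨ xor-interchange (A u) (A v) (S u) (S v) ⟩
    (A u xor S u) xor (A v xor S v)    ∎

  uncovered-edge : ¬ VertexCover G S → ∃[ u ] ∃[ v ] (Edge G u v × (S u ∨ S v) ≡ false)
  uncovered-edge ¬cover
    with any? (λ u → any? λ v → (adj G u v ≟ᵇ true) ×-dec ((S u ∨ S v) ≟ᵇ false))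
  ... | yes edge = edge
  ... | no ¬edge = case ¬cover cover of λ ()
    where
    cover : VertexCover G S
    cover u v uv with S u ∨ S v in eq
    ... | true  = refl
    ... | false = case ¬edge (u , v , uv , eq) of λ ()

  colourBy-isNAC : Bipartite G → StableSet G S → MeetsSomeEdge G S → ¬ VertexCover G S →
                   IsNAC G (colourBy G S)
  colourBy-isNAC (A , bipartition) stable (u , v , uv , u∈S) ¬cover =
      (λ u v _ → colourBy-sym u v)
    , (u , v , uv , colourBy-true (cong (_∨ S v) u∈S))
    , blue-edge (uncovered-edge ¬cover)
    , λ C → countColour≢1 G (colourBy G S) S (red-class-isCut stable) C
          , countColour≢1 G (colourBy G S) (λ w → A w xor S w) (blue-class-isCut A bipartition stable) C
    where
    blue-edge : ∃[ u ] ∃[ v ] (Edge G u v × (S u ∨ S v) ≡ false) →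
                ∃[ u ] ∃[ v ] (Edge G u v × colourBy G S u v ≡ blue)
    blue-edge (u , v , uv , uncovered) = u , v , uv , colourBy-false uncovered

lemma4p3 : (G : Graph) (S : VSet G) → Bipartite G → StableSet G S
    → MeetsSomeEdge G S → ¬ VertexCover G S
    → IsNAC G (colourBy G S) × IsStableNAC G (colourBy G S)
lemma4p3 G S bipartite stable meets ¬cover =
  nac , nac , S , stable , red , blue , (λ ()) ,
  λ _ _ _ → colourBy-true G S , colourBy-false G S
  where
  nac : IsNAC G (colourBy G S)
  nac = colourBy-isNAC G S bipartite stable meets ¬cover
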